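{- For all integers $r\geq 2$ and $d\geq 1$ there exists a triangle-free $d$-degenerate $r$-uniform hypergraph with chromatic number $d+1$.
   Context: A hypergraph $G$ consists of a set $V(G)$ of vertices and a set $E(G)$ of subsets of $V(G)$ called edges; it is $r$-uniform if every edge has exactly $r$ vertices. A hypergraph $H$ is a subhypergraph of $G$ if $V(H)\subseteq V(G)$ and $E(H)\subseteq E(G)$. The degree of a vertex $v$ is the number of edges containing $v$. A hypergraph is $d$-degenerate if every subhypergraph with at least one vertex has a vertex of degree at most $d$. A colouring of $G$ assigns one colour to each vertex so that no edge is monochromatic; the chromatic number is the minimum number of colours in a colouring. A triangle in an $r$-uniform hypergraph consists of three edges whose union is a set of exactly $r+1$ vertices; a hypergraph is triangle-free if it contains no triangle. -}

module Defs where

open import Data.Nat using (ℕ; suc; _≤_)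
open import Data.Fin using (Fin)
open import Data.Fin.Subset using (Subset; _∈_; _⊆_; _∩_; _∪_; ∣_∣)
open import Data.Vec using (tabulate; lookup)
open import Data.Product using (Σ; ∃; _×_)
open import Relation.Binary.PropositionalEquality using (_≡_; _≢_)
open import Relation.Nullary using (¬_)
open import Function.Definitions using (Injective)

record Hypergraph : Set where
  field
    n        : ℕ
    m        : ℕ
    edge     : Fin m → Subset n
    edge-inj : Injective _≡_ _≡_ edge
open Hypergraph public

Uniform : ℕ → Hypergraph → Set
Uniform r G = ∀ e → ∣ edge G e ∣ ≡ r

incident : (G : Hypergraph) → Fin (n G) → Subset (m G)
incident G v = tabulate (λ e → lookup (edge G e) v)

record Sub (G : Hypergraph) : Set where
  field
    W     : Subset (n G)
    F     : Subset (m G)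
    F⊆W   : ∀ {e} → e ∈ F → edge G e ⊆ W
open Sub public

degree : {G : Hypergraph} → Sub G → Fin (n G) → ℕ
degree {G} H v = ∣ F H ∩ incident G v ∣

Degenerate : ℕ → Hypergraph → Set
Degenerate d G = (H : Sub G) → (∃ λ v → v ∈ W H) →
                 ∃ λ v → v ∈ W H × degree H v ≤ d

Colouring : (G : Hypergraph) → ℕ → Set
Colouring G k =
  Σ (Fin (n G) → Fin k) λ c →
    ∀ e → ∃ λ u → ∃ λ v → u ∈ edge G e × v ∈ edge G e × c u ≢ c v

ChromaticNumber : Hypergraph → ℕ → Set
ChromaticNumber G k = Colouring G k × (∀ j → suc j ≤ k → ¬ Colouring G j)

-- triangle in an r-uniform hypergraph: three (distinct) edges whose union
-- has exactly r+1 vertices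
TriangleFree : ℕ → Hypergraph → Set
TriangleFree r G = ∀ e₁ e₂ e₃ → e₁ ≢ e₂ → e₁ ≢ e₃ → e₂ ≢ e₃ →
  ∣ (edge G e₁ ∪ edge G e₂) ∪ edge G e₃ ∣ ≢ suc r

-- Induction on k, the chromatic number. Let G be r-uniform, (k−1)-degenerate, of chromatic
-- number k, and such that any three distinct edges cover at least r + 2 vertices. Take k·(r−1)
-- disjoint copies of G, arranged in k rows of r−1 copies. For every transversal t, choosing one
-- vertex in each copy, add an apex vertex and k fan edges, the i-th consisting of the apex and
-- the r−1 vertices chosen by t in row i. In a k-colouring every copy uses all k colours, so some
-- t chooses a vertex of colour i in every copy of row i; the fan of t over the row named by the
-- colour of its apex is then monochromatic. A fresh colour on the apices gives a (k+1)-colouring.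
-- Apices have degree k, and once they are gone only copies of G remain: k-degeneracy. Two edges
-- not in a common copy share at most one vertex, which keeps the three-edge condition.

module Submission where

open import Defs
open import Data.Bool using (true; false)
open import Data.Fin as Fin using (Fin; zero; suc; combine; remQuot; finToFun; funToFin; punchOut; inject≤)
open import Data.Fin.Properties as Fin
  using (_≟_; any?; 0≢1+n; suc-injective; +↔⊎; *↔×; remQuot-combine; combine-remQuot;
         combine-injectiveˡ; combine-injectiveʳ; punchOut-injective; inject≤-injective)
open import Data.Fin.Subset using (Subset; _∈_; _∉_; _⊆_; _∩_; _∪_; _-_; ∣_∣; ⊤; Nonempty)
open import Data.Fin.Subset.Properties
  using (_∈?_; nonempty?; drop-there; x∈p∧x≢y⇒x∈p-y; x∈p⇒∣p-x∣<∣p∣; p⊂q⇒∣p∣<∣q∣; Empty-unique; ∣⊥∣≡0;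
         ⊆-antisym; ∈⊤; ∣⊤∣≡n; x∈p∩q⁺; x∈p∩q⁻; p⊆p∪q; q⊆p∪q)
open import Data.Nat as ℕ using (ℕ; zero; suc; _≤_; _*_; _+_; _^_; z≤n; s≤s)
open import Data.Nat.Properties as ℕ using (≤-trans)
open import Data.Product using (Σ; ∃; ∃₂; _×_; _,_; proj₁; proj₂)
open import Data.Sum using (_⊎_; inj₁; inj₂)
open import Data.Sum.Function.Propositional using (_⊎-↔_)
open import Data.Sum.Properties using (inj₁-injective)
open import Data.Vec using (_∷_; []; tabulate; here; there)
open import Data.Vec.Properties using (lookup∘tabulate; []=⇒lookup; lookup⇒[]=)
open import Function using (_∘_)
open import Function.Bundles using (_↔_; Inverse)
open import Function.Definitions using (Injective)
open import Function.Properties.Inverse using (↔-trans; ↔-refl)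
open import Relation.Binary.PropositionalEquality
open import Relation.Nullary using (¬_; Dec; yes; no; does; contradiction)
open import Relation.Nullary.Decidable using (dec-true)
open import Relation.Unary using (Decidable)

module _ {n} {P : Fin n → Set} (P? : Decidable P) where

  ∈-tabulate⁺ : ∀ {v} → P v → v ∈ tabulate (does ∘ P?)
  ∈-tabulate⁺ {v} p = lookup⇒[]= v _ (trans (lookup∘tabulate _ v) (dec-true (P? v) p))

  ∈-tabulate⁻ : ∀ {v} → v ∈ tabulate (does ∘ P?) → P v
  ∈-tabulate⁻ {v} v∈ with P? v | trans (sym (lookup∘tabulate (does ∘ P?) v)) ([]=⇒lookup v∈)
  ... | yes p | _ = p

1≤∣p∣⇒Nonempty : ∀ {n} (p : Subset n) → 1 ≤ ∣ p ∣ → Nonempty p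
1≤∣p∣⇒Nonempty (true ∷ p)  _ = zero , here
1≤∣p∣⇒Nonempty (false ∷ p) h = let y , y∈ = 1≤∣p∣⇒Nonempty p h in suc y , there y∈

2≤∣p∣⇒two-elements : ∀ {n} (p : Subset n) → 2 ≤ ∣ p ∣ → ∃₂ λ y z → y ≢ z × y ∈ p × z ∈ p
2≤∣p∣⇒two-elements (true ∷ p) (s≤s h) = let z , z∈ = 1≤∣p∣⇒Nonempty p h in zero , suc z , 0≢1+n , here , there z∈
2≤∣p∣⇒two-elements (false ∷ p) h =
  let y , z , y≢z , y∈ , z∈ = 2≤∣p∣⇒two-elements p h in suc y , suc z , y≢z ∘ suc-injective , there y∈ , there z∈

∈∉-there : ∀ {n} {p q : Subset n} {b c} → (∃ λ v → v ∈ q × v ∉ p) → ∃ λ v → v ∈ c ∷ q × v ∉ b ∷ p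
∈∉-there (v , v∈q , v∉p) = suc v , there v∈q , v∉p ∘ drop-there

∣p∣≤∣q∣∧p≢q⇒q⊈p : ∀ {n} (p q : Subset n) → ∣ p ∣ ≤ ∣ q ∣ → p ≢ q → ∃ λ v → v ∈ q × v ∉ p
∣p∣≤∣q∣∧p≢q⇒q⊈p []          []          _       p≢q = contradiction refl p≢q
∣p∣≤∣q∣∧p≢q⇒q⊈p (false ∷ p) (true ∷ q)  _       _   = zero , here , λ ()
∣p∣≤∣q∣∧p≢q⇒q⊈p (true ∷ p)  (false ∷ q) ∣p∣<∣q∣ _   =
  ∈∉-there (∣p∣≤∣q∣∧p≢q⇒q⊈p p q (ℕ.<⇒≤ ∣p∣<∣q∣) λ { refl → ℕ.<-irrefl refl ∣p∣<∣q∣ })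
∣p∣≤∣q∣∧p≢q⇒q⊈p (true ∷ p)  (true ∷ q)  (s≤s h) p≢q = ∈∉-there (∣p∣≤∣q∣∧p≢q⇒q⊈p p q h (p≢q ∘ cong (true ∷_)))
∣p∣≤∣q∣∧p≢q⇒q⊈p (false ∷ p) (false ∷ q) h       p≢q = ∈∉-there (∣p∣≤∣q∣∧p≢q⇒q⊈p p q h (p≢q ∘ cong (false ∷_)))

injective-on⇒∣p∣≤∣q∣ : ∀ {m n} (f : Fin m → Fin n) (p : Subset m) (q : Subset n) →
  (∀ {u w} → u ∈ p → w ∈ p → f u ≡ f w → u ≡ w) → (∀ {u} → u ∈ p → f u ∈ q) → ∣ p ∣ ≤ ∣ q ∣
injective-on⇒∣p∣≤∣q∣ f []          q inj into = z≤n
injective-on⇒∣p∣≤∣q∣ f (false ∷ p) q inj into =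
  injective-on⇒∣p∣≤∣q∣ (f ∘ suc) p q (λ u∈ w∈ → suc-injective ∘ inj (there u∈) (there w∈)) (into ∘ there)
injective-on⇒∣p∣≤∣q∣ f (true ∷ p)  q inj into = ≤-trans (s≤s ∣p∣≤∣q-f0∣) (x∈p⇒∣p-x∣<∣p∣ (into here))
  where
  ∣p∣≤∣q-f0∣ : ∣ p ∣ ≤ ∣ q - f zero ∣
  ∣p∣≤∣q-f0∣ = injective-on⇒∣p∣≤∣q∣ (f ∘ suc) p (q - f zero)
    (λ u∈ w∈ → suc-injective ∘ inj (there u∈) (there w∈))
    (λ u∈ → x∈p∧x≢y⇒x∈p-y (into (there u∈)) (0≢1+n ∘ inj here (there u∈) ∘ sym))

covered⇒∣q∣≤∣p∣ : ∀ {m n} (f : Fin m → Fin n) (p : Subset m) (q : Subset n) →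
  (∀ {v} → v ∈ q → ∃ λ u → u ∈ p × f u ≡ v) → ∣ q ∣ ≤ ∣ p ∣
covered⇒∣q∣≤∣p∣ {n = n} f p q cover with nonempty? q
... | no q-empty = subst (_≤ ∣ p ∣) (sym (trans (cong ∣_∣ (Empty-unique q-empty)) (∣⊥∣≡0 n))) z≤n
... | yes (v₀ , v₀∈q) = injective-on⇒∣p∣≤∣q∣ preimage q p
        (λ {u} {w} u∈ w∈ eq → trans (sym (preimage-sound u∈ .proj₂)) (trans (cong f eq) (preimage-sound w∈ .proj₂)))
        (λ u∈ → preimage-sound u∈ .proj₁)
  where
  preimage : Fin n → Fin _
  preimage v with v ∈? q
  ... | yes v∈q = cover v∈q .proj₁
  ... | no  _   = cover v₀∈q .proj₁
  preimage-sound : ∀ {v} → v ∈ q → preimage v ∈ p × f (preimage v) ≡ v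
  preimage-sound {v} v∈q with v ∈? q
  ... | yes v∈q′ = cover v∈q′ .proj₂
  ... | no  v∉q  = contradiction v∈q v∉q

two-outside⇒∣p∣+2≤∣q∣ : ∀ {n} {p q : Subset n} {y z} → p ⊆ q → y ≢ z → y ∈ q → z ∈ q → y ∉ p → z ∉ p →
  suc (suc ∣ p ∣) ≤ ∣ q ∣
two-outside⇒∣p∣+2≤∣q∣ {p = p} {q} {y} {z} p⊆q y≢z y∈q z∈q y∉p z∉p =
  ≤-trans (s≤s (p⊂q⇒∣p∣<∣q∣ (p⊆q-z , y , x∈p∧x≢y⇒x∈p-y y∈q y≢z , y∉p))) (x∈p⇒∣p-x∣<∣p∣ z∈q)
  where
  p⊆q-z : p ⊆ q - z
  p⊆q-z x∈p = x∈p∧x≢y⇒x∈p-y (p⊆q x∈p) λ { refl → z∉p x∈p }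

infix 9 _⁻¹[_]
_⁻¹[_] : ∀ {m n} → (Fin m → Fin n) → Subset n → Subset m
f ⁻¹[ p ] = tabulate (does ∘ λ u → f u ∈? p)

∈-⁻¹⁺ : ∀ {m n} (f : Fin m → Fin n) {p u} → f u ∈ p → u ∈ f ⁻¹[ p ]
∈-⁻¹⁺ f {p} = ∈-tabulate⁺ (λ u → f u ∈? p)

∈-⁻¹⁻ : ∀ {m n} (f : Fin m → Fin n) {p u} → u ∈ f ⁻¹[ p ] → f u ∈ p
∈-⁻¹⁻ f {p} = ∈-tabulate⁻ (λ u → f u ∈? p)

_∋ᴳ_ : ∀ {G} → Fin (m G) → Fin (n G) → Set
_∋ᴳ_ {G} e v = v ∈ edge G e

OneOf : {E : Set} → (E → Set) → E → E → E → Set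
OneOf P e₁ e₂ e₃ = P e₁ ⊎ P e₂ ⊎ P e₃

pattern at₁ p = inj₁ p
pattern at₂ p = inj₂ (inj₁ p)
pattern at₃ p = inj₂ (inj₂ p)

OneOf-map : ∀ {E E′ : Set} {P : E → Set} {P′ : E′ → Set} (f : E → E′) → (∀ {e} → P e → P′ (f e)) →
  ∀ {e₁ e₂ e₃} → OneOf P e₁ e₂ e₃ → OneOf P′ (f e₁) (f e₂) (f e₃)
OneOf-map f φ (at₁ p) = at₁ (φ p)
OneOf-map f φ (at₂ p) = at₂ (φ p)
OneOf-map f φ (at₃ p) = at₃ (φ p)

swap₁₂ : ∀ {A B C : Set} → A ⊎ B ⊎ C → B ⊎ A ⊎ C
swap₁₂ (at₁ a) = at₂ a
swap₁₂ (at₂ b) = at₁ b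
swap₁₂ (at₃ c) = at₃ c

swap₂₃ : ∀ {A B C : Set} → A ⊎ B ⊎ C → A ⊎ C ⊎ B
swap₂₃ (at₁ a) = at₁ a
swap₂₃ (at₂ b) = at₃ b
swap₂₃ (at₃ c) = at₂ c

module _ {E V : Set} (_∋_ : E → V → Set) where

  -- Two vertices covered by e₁, e₂, e₃ but missing one of them: in an r-uniform hypergraph the
  -- union then has at least r + 2 vertices, and this form survives the inductive construction.
  record Spread (e₁ e₂ e₃ : E) : Set where
    constructor spread
    field
      f   : E
      f∈  : OneOf (f ≡_) e₁ e₂ e₃
      y z : V
      y≢z : y ≢ z
      y∈  : OneOf (_∋ y) e₁ e₂ e₃
      z∈  : OneOf (_∋ z) e₁ e₂ e₃
      f∌y : ¬ f ∋ y
      f∌z : ¬ f ∋ z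

  StronglyTriangleFree : Set
  StronglyTriangleFree = ∀ e₁ e₂ e₃ → e₁ ≢ e₂ → e₁ ≢ e₃ → e₂ ≢ e₃ → Spread e₁ e₂ e₃

module _ {E V : Set} {_∋_ : E → V → Set} where

  Spread-reorder : ∀ {e₁ e₂ e₃ e₁′ e₂′ e₃′} →
    (∀ {P} → OneOf P e₁ e₂ e₃ → OneOf P e₁′ e₂′ e₃′) → Spread _∋_ e₁ e₂ e₃ → Spread _∋_ e₁′ e₂′ e₃′
  Spread-reorder σ (spread f f∈ y z y≢z y∈ z∈ f∌y f∌z) = spread f (σ f∈) y z y≢z (σ y∈) (σ z∈) f∌y f∌z

Spread-map : ∀ {E V E′ V′} {_∋_ : E → V → Set} {_∋′_ : E′ → V′ → Set} (f : E → E′) (g : V → V′) →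
  Injective _≡_ _≡_ g → (∀ {e v} → e ∋ v → f e ∋′ g v) → (∀ {e v} → f e ∋′ g v → e ∋ v) →
  ∀ {e₁ e₂ e₃} → Spread _∋_ e₁ e₂ e₃ → Spread _∋′_ (f e₁) (f e₂) (f e₃)
Spread-map {_∋_ = _∋_} {_∋′_} f g g-inj preserve reflect (spread h h∈ y z y≢z y∈ z∈ h∌y h∌z) =
  spread (f h) (OneOf-map {P = h ≡_} {P′ = f h ≡_} f (cong f) h∈) (g y) (g z) (y≢z ∘ g-inj)
         (OneOf-map {P = _∋ y} {P′ = _∋′ g y} f preserve y∈)
         (OneOf-map {P = _∋ z} {P′ = _∋′ g z} f preserve z∈) (h∌y ∘ reflect) (h∌z ∘ reflect)

Spread⇒r+2≤∣∪∣ : ∀ {r G e₁ e₂ e₃} → Uniform r G → Spread (_∋ᴳ_ {G}) e₁ e₂ e₃ →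
  suc (suc r) ≤ ∣ (edge G e₁ ∪ edge G e₂) ∪ edge G e₃ ∣
Spread⇒r+2≤∣∪∣ {r} {G} {e₁} {e₂} {e₃} uniform (spread f f∈ y z y≢z y∈ z∈ f∌y f∌z) =
  subst (λ ∣f∣ → suc (suc ∣f∣) ≤ _) (uniform f) (two-outside⇒∣p∣+2≤∣q∣ (edge⊆∪ f∈) y≢z (∈∪ y∈) (∈∪ z∈) f∌y f∌z)
  where
  ∈∪ : ∀ {v} → OneOf (λ e → v ∈ edge G e) e₁ e₂ e₃ → v ∈ (edge G e₁ ∪ edge G e₂) ∪ edge G e₃
  ∈∪ (at₁ v∈) = p⊆p∪q _ (p⊆p∪q _ v∈)
  ∈∪ (at₂ v∈) = p⊆p∪q _ (q⊆p∪q _ _ v∈)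
  ∈∪ (at₃ v∈) = q⊆p∪q _ _ v∈
  edge⊆∪ : ∀ {e} → OneOf (e ≡_) e₁ e₂ e₃ → edge G e ⊆ (edge G e₁ ∪ edge G e₂) ∪ edge G e₃
  edge⊆∪ (at₁ refl) = ∈∪ ∘ at₁
  edge⊆∪ (at₂ refl) = ∈∪ ∘ at₂
  edge⊆∪ (at₃ refl) = ∈∪ ∘ at₃

stronglyTriangleFree⇒triangleFree : ∀ {r G} → Uniform r G → StronglyTriangleFree (_∋ᴳ_ {G}) → TriangleFree r G
stronglyTriangleFree⇒triangleFree {r} {G} uniform stf e₁ e₂ e₃ e₁≢e₂ e₁≢e₃ e₂≢e₃ ∣∪∣≡r+1 =
  ℕ.<-irrefl (sym ∣∪∣≡r+1) (Spread⇒r+2≤∣∪∣ {G = G} uniform (stf e₁ e₂ e₃ e₁≢e₂ e₁≢e₃ e₂≢e₃))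

colouring-≤ : ∀ {G j k} → j ≤ k → Colouring G j → Colouring G k
colouring-≤ j≤k (κ , proper) = (λ u → inject≤ (κ u) j≤k) , λ e →
  let u , v , u∈ , v∈ , κu≢κv = proper e in
  u , v , u∈ , v∈ , κu≢κv ∘ inject≤-injective j≤k j≤k _ _

chromatic⇒colouring-surjective : ∀ {G k} → ChromaticNumber G k → ((κ , _) : Colouring G k) → ∀ α → ∃ λ u → κ u ≡ α
chromatic⇒colouring-surjective {G} {suc k} (_ , no-fewer) (κ , proper) α with any? (λ u → κ u ≟ α)
... | yes found = found
... | no α-unused = contradiction (κ′ , proper′) (no-fewer k ℕ.≤-refl)
  where
  κ′ : Fin (n G) → Fin k
  κ′ u = punchOut {i = α} {j = κ u} λ α≡κu → α-unused (u , sym α≡κu)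
  proper′ : ∀ e → ∃ λ u → ∃ λ v → u ∈ edge G e × v ∈ edge G e × κ′ u ≢ κ′ v
  proper′ e = let u , v , u∈ , v∈ , κu≢κv = proper e in
    u , v , u∈ , v∈ , κu≢κv ∘ punchOut-injective {i = α} _ _

∈-incident⁺ : ∀ {G e v} → v ∈ edge G e → e ∈ incident G v
∈-incident⁺ {G} {e} {v} v∈ = lookup⇒[]= e _ (trans (lookup∘tabulate _ e) ([]=⇒lookup v∈))

∈-incident⁻ : ∀ {G e v} → e ∈ incident G v → v ∈ edge G e
∈-incident⁻ {G} {e} {v} e∈ = lookup⇒[]= v _ (trans (sym (lookup∘tabulate _ e)) ([]=⇒lookup e∈))

data Image {A B : Set} (f : A → B) : B → Set where
  image : ∀ a → Image f (f a)

image-of-inverse : ∀ {A B : Set} (e : A ↔ B) b → Image (Inverse.from e) b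
image-of-inverse e b = subst (Image (Inverse.from e)) (Inverse.strictlyInverseʳ e b) (image (Inverse.to e b))

-- Copies of G are indexed by Fin Q, row i holding the copies combine i j; the transversals are
-- the elements of Fin T, read as functions Fin Q → Fin (n G) by pick.
module Extension (s k : ℕ) (G : Hypergraph) (uniform : Uniform (suc (suc s)) G) where

  Q : ℕ
  Q = k * suc s

  T : ℕ
  T = n G ^ Q

  row : Fin Q → Fin k
  row q = proj₁ (remQuot (suc s) q)

  pick : Fin T → Fin Q → Fin (n G)
  pick = finToFun

  VCode ECode : Set
  VCode = (Fin Q × Fin (n G)) ⊎ Fin T
  ECode = (Fin Q × Fin (m G)) ⊎ (Fin T × Fin k)

  pattern inCopy q x = inj₁ (q , x)
  pattern apex t     = inj₂ t
  pattern fan t i    = inj₂ (t , i)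

  data _∋_ : ECode → VCode → Set where
    copy∋ : ∀ {q e u} → u ∈ edge G e → inCopy q e ∋ inCopy q u
    apex∋ : ∀ {t i} → fan t i ∋ apex t
    pick∋ : ∀ {t q} → fan t (row q) ∋ inCopy q (pick t q)

  _∋?_ : ∀ c x → Dec (c ∋ x)
  inCopy q e ∋? inCopy q′ u with q ≟ q′ | u ∈? edge G e
  ... | yes refl | yes u∈ = yes (copy∋ u∈)
  ... | no q≢q′  | _      = no λ { (copy∋ _) → q≢q′ refl }
  ... | yes _    | no u∉  = no λ { (copy∋ u∈) → u∉ u∈ }
  inCopy _ _ ∋? apex _ = no λ ()
  fan t i ∋? inCopy q u with row q ≟ i | u ≟ pick t q
  ... | yes refl | yes refl = yes pick∋
  ... | no ≢i    | _        = no λ { pick∋ → ≢i refl }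
  ... | yes _    | no ≢pick = no λ { pick∋ → ≢pick refl }
  fan t i ∋? apex t′ with t ≟ t′
  ... | yes refl = yes apex∋
  ... | no t≢t′  = no λ { apex∋ → t≢t′ refl }

  vertexCode : Fin (Q * n G + T) ↔ VCode
  vertexCode = ↔-trans +↔⊎ (*↔× ⊎-↔ ↔-refl)

  edgeCode : Fin (Q * m G + T * k) ↔ ECode
  edgeCode = ↔-trans +↔⊎ (*↔× ⊎-↔ *↔×)

  open Inverse vertexCode using () renaming (to to decodeᵛ; from to encodeᵛ; strictlyInverseˡ to decodeᵛ∘encodeᵛ)
  open Inverse edgeCode using () renaming (to to decodeᵉ; from to encodeᵉ; strictlyInverseˡ to decodeᵉ∘encodeᵉ)

  edge′ : Fin (Q * m G + T * k) → Subset (Q * n G + T)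
  edge′ ε = tabulate (does ∘ λ v → decodeᵉ ε ∋? decodeᵛ v)

  ∋⇒∈ : ∀ {c x} → c ∋ x → encodeᵛ x ∈ edge′ (encodeᵉ c)
  ∋⇒∈ {c} {x} c∋x = ∈-tabulate⁺ (λ v → decodeᵉ (encodeᵉ c) ∋? decodeᵛ v)
    (subst₂ _∋_ (sym (decodeᵉ∘encodeᵉ c)) (sym (decodeᵛ∘encodeᵛ x)) c∋x)

  ∈⇒∋ : ∀ {c x} → encodeᵛ x ∈ edge′ (encodeᵉ c) → c ∋ x
  ∈⇒∋ {c} {x} x∈ = subst₂ _∋_ (decodeᵉ∘encodeᵉ c) (decodeᵛ∘encodeᵛ x)
    (∈-tabulate⁻ (λ v → decodeᵉ (encodeᵉ c) ∋? decodeᵛ v) x∈)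

  row-combine : ∀ i j → row (combine i j) ≡ i
  row-combine i j = cong proj₁ (remQuot-combine i j)

  leg : Fin T → Fin k → Fin (suc s) → VCode
  leg t i j = inCopy (combine i j) (pick t (combine i j))

  fan∋leg : ∀ {t i j} → fan t i ∋ leg t i j
  fan∋leg {t} {i} {j} = subst (λ i′ → fan t i′ ∋ leg t i j) (row-combine i j) pick∋

  copy∋⁻ : ∀ {q q′ e u} → inCopy q e ∋ inCopy q′ u → u ∈ edge G e
  copy∋⁻ (copy∋ u∈) = u∈

  two-vertices : ∀ e → ∃₂ λ u w → u ≢ w × u ∈ edge G e × w ∈ edge G e
  two-vertices e = 2≤∣p∣⇒two-elements (edge G e) (subst (2 ≤_) (sym (uniform e)) (s≤s (s≤s z≤n)))

  ∋-injective : ∀ {c c′} → (∀ {x} → c ∋ x → c′ ∋ x) → (∀ {x} → c′ ∋ x → c ∋ x) → c ≡ c′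
  ∋-injective {inCopy q e} {inCopy q′ e′} c⊆c′ c′⊆c with two-vertices e
  ... | u , _ , _ , u∈ , _ with c⊆c′ (copy∋ {q} u∈)
  ... | copy∋ _ = cong (inCopy q) (edge-inj G (⊆-antisym (copy∋⁻ ∘ c⊆c′ ∘ copy∋) (copy∋⁻ ∘ c′⊆c ∘ copy∋)))
  ∋-injective {inCopy _ _} {fan _ _}    _ c′⊆c = contradiction (c′⊆c apex∋) λ ()
  ∋-injective {fan _ _}    {inCopy _ _} c⊆c′ _ = contradiction (c⊆c′ apex∋) λ ()
  ∋-injective {fan t i}    {fan _ _}    c⊆c′ _ with c⊆c′ (apex∋ {t} {i})
  ... | apex∋ with c⊆c′ (fan∋leg {t} {i} {zero})
  ... | pick∋ = cong (fan t) (sym (row-combine i zero))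

  encodeᵛ-injective : Injective _≡_ _≡_ encodeᵛ
  encodeᵛ-injective {x} {y} eq = trans (sym (decodeᵛ∘encodeᵛ x)) (trans (cong decodeᵛ eq) (decodeᵛ∘encodeᵛ y))

  edge′-injective : Injective _≡_ _≡_ edge′
  edge′-injective {ε} {ε′} eq with image-of-inverse edgeCode ε | image-of-inverse edgeCode ε′
  ... | image c | image c′ = cong encodeᵉ (∋-injective (transfer {c} {c′} eq) (transfer {c′} {c} (sym eq)))
    where
    transfer : ∀ {c c′} → edge′ (encodeᵉ c) ≡ edge′ (encodeᵉ c′) → ∀ {x} → c ∋ x → c′ ∋ x
    transfer eq {x} = ∈⇒∋ ∘ subst (encodeᵛ x ∈_) eq ∘ ∋⇒∈

  G′ : Hypergraph
  G′ = record { n = Q * n G + T ; m = Q * m G + T * k ; edge = edge′ ; edge-inj = edge′-injective }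

  ∣edge′∣≡∣p∣ : ∀ {ℓ c} (g : Fin ℓ → VCode) (p : Subset ℓ) → Injective _≡_ _≡_ g →
    (∀ {u} → u ∈ p → c ∋ g u) → (∀ {x} → c ∋ x → ∃ λ u → u ∈ p × g u ≡ x) → ∣ edge′ (encodeᵉ c) ∣ ≡ ∣ p ∣
  ∣edge′∣≡∣p∣ {c = c} g p g-injective into onto = ℕ.≤-antisym
    (covered⇒∣q∣≤∣p∣ (encodeᵛ ∘ g) p _ onto′)
    (injective-on⇒∣p∣≤∣q∣ (encodeᵛ ∘ g) p _ (λ _ _ → g-injective ∘ encodeᵛ-injective) (∋⇒∈ ∘ into))
    where
    onto′ : ∀ {v} → v ∈ edge′ (encodeᵉ c) → ∃ λ u → u ∈ p × encodeᵛ (g u) ≡ v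
    onto′ {v} v∈ with image-of-inverse vertexCode v
    ... | image x = let u , u∈ , gu≡x = onto (∈⇒∋ {c} {x} v∈) in u , u∈ , cong encodeᵛ gu≡x

  fanVertex : Fin T → Fin k → Fin (suc (suc s)) → VCode
  fanVertex t i zero    = apex t
  fanVertex t i (suc j) = leg t i j

  fanVertex-injective : ∀ {t i} → Injective _≡_ _≡_ (fanVertex t i)
  fanVertex-injective {x = zero}  {zero}  _  = refl
  fanVertex-injective {t} {i} {suc j} {suc j′} eq =
    cong suc (combine-injectiveʳ i j i j′ (cong proj₁ (inj₁-injective eq)))

  G′-uniform : Uniform (suc (suc s)) G′
  G′-uniform ε with image-of-inverse edgeCode ε
  ... | image (inCopy q e) =
    trans (∣edge′∣≡∣p∣ (inCopy q) (edge G e) (λ { refl → refl }) copy∋ λ { (copy∋ u∈) → _ , u∈ , refl }) (uniform e)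
  ... | image (fan t i) =
    trans (∣edge′∣≡∣p∣ (fanVertex t i) ⊤ fanVertex-injective fan∋ fan-onto) (∣⊤∣≡n _)
    where
    fan∋ : ∀ {j} → j ∈ ⊤ → fan t i ∋ fanVertex t i j
    fan∋ {zero}  _ = apex∋
    fan∋ {suc j} _ = fan∋leg
    fan-onto : ∀ {x} → fan t i ∋ x → ∃ λ j → j ∈ ⊤ × fanVertex t i j ≡ x
    fan-onto apex∋           = zero , ∈⊤ , refl
    fan-onto (pick∋ {q = q}) = suc (proj₂ (remQuot {k} (suc s) q)) , ∈⊤ ,
      cong (λ q′ → inCopy q′ (pick t q′)) (combine-remQuot {k} (suc s) q)

  apex-degree : ∀ H t → degree {G′} H (encodeᵛ (apex t)) ≤ k
  apex-degree H t = ≤-trans (covered⇒∣q∣≤∣p∣ (encodeᵉ ∘ fan t) ⊤ _ onto) (ℕ.≤-reflexive (∣⊤∣≡n k))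
    where
    onto : ∀ {ε} → ε ∈ F H ∩ incident G′ (encodeᵛ (apex t)) → ∃ λ i → i ∈ ⊤ × encodeᵉ (fan t i) ≡ ε
    onto {ε} ε∈ with image-of-inverse edgeCode ε
    ... | image c with ∈⇒∋ {c} {apex t} (∈-incident⁻ {G′} (x∈p∩q⁻ (F H) _ ε∈ .proj₂))
    ... | apex∋ {i = i} = i , ∈⊤ , refl

  restrictToCopy : Sub G′ → Fin Q → Sub G
  restrictToCopy H q = record
    { W   = (encodeᵛ ∘ inCopy q) ⁻¹[ W H ]
    ; F   = (encodeᵉ ∘ inCopy q) ⁻¹[ F H ]
    ; F⊆W = λ e∈ u∈ → ∈-⁻¹⁺ (encodeᵛ ∘ inCopy q) (F⊆W H (∈-⁻¹⁻ (encodeᵉ ∘ inCopy q) e∈) (∋⇒∈ (copy∋ u∈)))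
    }

  copy-degree : ∀ H q u → (∀ t → encodeᵛ (apex t) ∉ W H) →
    degree {G′} H (encodeᵛ (inCopy q u)) ≤ degree (restrictToCopy H q) u
  copy-degree H q u no-apex = covered⇒∣q∣≤∣p∣ (encodeᵉ ∘ inCopy q) _ _ onto
    where
    onto : ∀ {ε} → ε ∈ F H ∩ incident G′ (encodeᵛ (inCopy q u)) →
      ∃ λ e → e ∈ F (restrictToCopy H q) ∩ incident G u × encodeᵉ (inCopy q e) ≡ ε
    onto {ε} ε∈ with image-of-inverse edgeCode ε | x∈p∩q⁻ (F H) _ ε∈
    ... | image c | ε∈F , ε∋u with ∈⇒∋ {c} {inCopy q u} (∈-incident⁻ {G′} ε∋u)
    ... | copy∋ u∈ = _ , x∈p∩q⁺ (∈-⁻¹⁺ (encodeᵉ ∘ inCopy q) ε∈F , ∈-incident⁺ {G} u∈) , refl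
    ... | pick∋ {t} = contradiction (F⊆W H ε∈F (∋⇒∈ (apex∋ {t}))) (no-apex t)

  G′-degenerate : Degenerate (ℕ.pred k) G → Degenerate k G′
  G′-degenerate degenerate H (w , w∈) with any? (λ t → encodeᵛ (apex t) ∈? W H)
  ... | yes (t , apex∈) = encodeᵛ (apex t) , apex∈ , apex-degree H t
  ... | no apex∉ with image-of-inverse vertexCode w
  ...   | image (apex t) = contradiction (t , w∈) apex∉
  ...   | image (inCopy q u) =
    let u₀ , u₀∈ , deg≤ = degenerate (restrictToCopy H q) (u , ∈-⁻¹⁺ (encodeᵛ ∘ inCopy q) w∈) in
    encodeᵛ (inCopy q u₀) , ∈-⁻¹⁻ (encodeᵛ ∘ inCopy q) u₀∈ ,
    ≤-trans (copy-degree H q u₀ (λ t apex∈ → apex∉ (t , apex∈))) (≤-trans deg≤ ℕ.pred[n]≤n)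

  ProperCodeColouring : ℕ → Set
  ProperCodeColouring j = Σ (VCode → Fin j) λ κ → ∀ c → ∃₂ λ x y → c ∋ x × c ∋ y × κ x ≢ κ y

  fromCodeColouring : ∀ {j} → ProperCodeColouring j → Colouring G′ j
  fromCodeColouring (κ , proper) = κ ∘ decodeᵛ , proper′
    where
    proper′ : ∀ ε → ∃ λ u → ∃ λ v → u ∈ edge′ ε × v ∈ edge′ ε × κ (decodeᵛ u) ≢ κ (decodeᵛ v)
    proper′ ε with image-of-inverse edgeCode ε
    ... | image c = let x , y , c∋x , c∋y , κx≢κy = proper c in
      encodeᵛ x , encodeᵛ y , ∋⇒∈ c∋x , ∋⇒∈ c∋y ,
      subst₂ (λ x′ y′ → κ x′ ≢ κ y′) (sym (decodeᵛ∘encodeᵛ x)) (sym (decodeᵛ∘encodeᵛ y)) κx≢κy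

  toCodeColouring : ∀ {j} → Colouring G′ j → ProperCodeColouring j
  toCodeColouring (κ , proper) = κ ∘ encodeᵛ , proper′
    where
    proper′ : ∀ c → ∃₂ λ x y → c ∋ x × c ∋ y × κ (encodeᵛ x) ≢ κ (encodeᵛ y)
    proper′ c with proper (encodeᵉ c)
    ... | u , v , u∈ , v∈ , κu≢κv with image-of-inverse vertexCode u | image-of-inverse vertexCode v
    ...   | image x | image y = x , y , ∈⇒∋ u∈ , ∈⇒∋ v∈ , κu≢κv

  extendColouring : Colouring G k → ProperCodeColouring (suc k)
  extendColouring (κ , proper) = κ′ , proper′
    where
    κ′ : VCode → Fin (suc k)
    κ′ (inCopy _ u) = Fin.inject₁ (κ u)
    κ′ (apex _)     = Fin.fromℕ k
    proper′ : ∀ c → ∃₂ λ x y → c ∋ x × c ∋ y × κ′ x ≢ κ′ y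
    proper′ (inCopy q e) = let u , v , u∈ , v∈ , κu≢κv = proper e in
      inCopy q u , inCopy q v , copy∋ u∈ , copy∋ v∈ , κu≢κv ∘ Fin.inject₁-injective
    proper′ (fan t i) = apex t , leg t i zero , apex∋ , fan∋leg , Fin.fromℕ≢inject₁

  no-k-colouring : ChromaticNumber G k → ¬ ProperCodeColouring k
  no-k-colouring chromatic (κ , proper) = monochromatic (proper (fan t α))
    where
    copyColouring : Fin Q → Colouring G k
    copyColouring q = κ ∘ inCopy q , λ e → restrict (proper (inCopy q e))
      where
      restrict : ∀ {e} → (∃₂ λ x y → inCopy q e ∋ x × inCopy q e ∋ y × κ x ≢ κ y) →
        ∃ λ u → ∃ λ v → u ∈ edge G e × v ∈ edge G e × κ (inCopy q u) ≢ κ (inCopy q v)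
      restrict (_ , _ , copy∋ u∈ , copy∋ v∈ , κu≢κv) = _ , _ , u∈ , v∈ , κu≢κv
    row-coloured : ∀ q → ∃ λ u → κ (inCopy q u) ≡ row q
    row-coloured q = chromatic⇒colouring-surjective {G} chromatic (copyColouring q) (row q)
    choice : Fin Q → Fin (n G)
    choice q = row-coloured q .proj₁
    t : Fin T
    t = funToFin choice
    α : Fin k
    α = κ (apex t)
    fan-coloured : ∀ {i x} → fan t i ∋ x → i ≡ α → κ x ≡ α
    fan-coloured apex∋           _    = refl
    fan-coloured (pick∋ {q = q}) row≡α = begin
      κ (inCopy q (pick t q))  ≡⟨ cong (κ ∘ inCopy q) (Fin.finToFun-funToFin choice q) ⟩
      κ (inCopy q (choice q))  ≡⟨ row-coloured q .proj₂ ⟩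
      row q                    ≡⟨ row≡α ⟩
      α                        ∎
      where open ≡-Reasoning
    monochromatic : ¬ ∃₂ λ x y → fan t α ∋ x × fan t α ∋ y × κ x ≢ κ y
    monochromatic (_ , _ , α∋x , α∋y , κx≢κy) =
      κx≢κy (trans (fan-coloured α∋x refl) (sym (fan-coloured α∋y refl)))

  G′-chromatic : ChromaticNumber G k → ChromaticNumber G′ (suc k)
  G′-chromatic chromatic =
    fromCodeColouring (extendColouring (proj₁ chromatic)) ,
    λ { j (s≤s j≤k) → no-k-colouring chromatic ∘ toCodeColouring ∘ colouring-≤ {G′} j≤k }

  copy∌ : ∀ {q q′ e u} → q′ ≢ q → ¬ inCopy q e ∋ inCopy q′ u
  copy∌ q′≢q (copy∋ _) = q′≢q refl

  fan∌apex : ∀ {t t′ i} → t′ ≢ t → ¬ fan t i ∋ apex t′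
  fan∌apex t′≢t apex∋ = t′≢t refl

  fan∌copy : ∀ {t i q u} → row q ≢ i → ¬ fan t i ∋ inCopy q u
  fan∌copy row≢i pick∋ = row≢i refl

  fan∌leg : ∀ {t t′ i i′ j} → i ≢ i′ → ¬ fan t′ i′ ∋ leg t i j
  fan∌leg i≢i′ = fan∌copy (i≢i′ ∘ trans (sym (row-combine _ _)))

  vertex-avoiding : ∀ e w → ∃ λ u → u ∈ edge G e × u ≢ w
  vertex-avoiding e w with two-vertices e
  ... | u , v , u≢v , u∈ , v∈ with u ≟ w
  ...   | yes refl = v , v∈ , u≢v ∘ sym
  ...   | no u≢w   = u , u∈ , u≢w

  vertex-outside : ∀ {e e′} → e ≢ e′ → ∃ λ v → v ∈ edge G e′ × v ∉ edge G e
  vertex-outside {e} {e′} e≢e′ = ∣p∣≤∣q∣∧p≢q⇒q⊈p (edge G e) (edge G e′)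
    (ℕ.≤-reflexive (trans (uniform e) (sym (uniform e′)))) (e≢e′ ∘ edge-inj G)

  spread-distinct-copies : ∀ {q₁ q₂ e₁ e₂ c} → q₁ ≢ q₂ → Spread _∋_ (inCopy q₁ e₁) (inCopy q₂ e₂) c
  spread-distinct-copies {q₁} {q₂} {e₁} {e₂} q₁≢q₂ with two-vertices e₂
  ... | u , w , u≢w , u∈ , w∈ =
    spread (inCopy q₁ e₁) (at₁ refl) (inCopy q₂ u) (inCopy q₂ w) (u≢w ∘ λ { refl → refl })
           (at₂ (copy∋ u∈)) (at₂ (copy∋ w∈)) (copy∌ (q₁≢q₂ ∘ sym)) (copy∌ (q₁≢q₂ ∘ sym))

  spread-copy-copy-copy : StronglyTriangleFree (_∋ᴳ_ {G}) → ∀ {q₁ q₂ q₃ e₁ e₂ e₃} →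
    (q₁ , e₁) ≢ (q₂ , e₂) → (q₁ , e₁) ≢ (q₃ , e₃) → (q₂ , e₂) ≢ (q₃ , e₃) →
    Spread _∋_ (inCopy q₁ e₁) (inCopy q₂ e₂) (inCopy q₃ e₃)
  spread-copy-copy-copy stf {q₁} {q₂} {q₃} {e₁} {e₂} {e₃} c₁≢c₂ c₁≢c₃ c₂≢c₃ with q₁ ≟ q₂ | q₁ ≟ q₃
  ... | no q₁≢q₂ | _        = spread-distinct-copies q₁≢q₂
  ... | yes refl | no q₁≢q₃ = Spread-reorder swap₂₃ (spread-distinct-copies q₁≢q₃)
  ... | yes refl | yes refl =
    Spread-map (inCopy q₁) (inCopy q₁) (λ { refl → refl }) copy∋ copy∋⁻
      (stf e₁ e₂ e₃ (c₁≢c₂ ∘ cong (q₁ ,_)) (c₁≢c₃ ∘ cong (q₁ ,_)) (c₂≢c₃ ∘ cong (q₁ ,_)))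

  spread-copy-copy-fan : ∀ {q₁ q₂ e₁ e₂ t i} → (q₁ , e₁) ≢ (q₂ , e₂) →
    Spread _∋_ (inCopy q₁ e₁) (inCopy q₂ e₂) (fan t i)
  spread-copy-copy-fan {q₁} {q₂} {e₁} {e₂} {t} c₁≢c₂ with q₁ ≟ q₂
  ... | no q₁≢q₂ = spread-distinct-copies q₁≢q₂
  ... | yes refl with vertex-outside (c₁≢c₂ ∘ cong (q₁ ,_))
  ...   | v , v∈e₂ , v∉e₁ =
    spread (inCopy q₁ e₁) (at₁ refl) (apex t) (inCopy q₁ v) (λ ())
           (at₃ apex∋) (at₂ (copy∋ v∈e₂)) (λ ()) (v∉e₁ ∘ copy∋⁻)

  spread-copy-fan-fan : ∀ {q e t₂ i₂ t₃ i₃} → (t₂ , i₂) ≢ (t₃ , i₃) →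
    Spread _∋_ (inCopy q e) (fan t₂ i₂) (fan t₃ i₃)
  spread-copy-fan-fan {q} {e} {t₂} {i₂} {t₃} {i₃} c₂≢c₃ with t₂ ≟ t₃
  ... | no t₂≢t₃ with vertex-avoiding e (pick t₂ q)
  ...   | u , u∈ , u≢pick =
    spread (fan t₂ i₂) (at₂ refl) (apex t₃) (inCopy q u) (λ ()) (at₃ apex∋) (at₁ (copy∋ u∈))
           (fan∌apex (t₂≢t₃ ∘ sym)) (λ { pick∋ → u≢pick refl })
  spread-copy-fan-fan {q} {e} {t} {i₂} {_} {i₃} c₂≢c₃ | yes refl with two-vertices e | row q ≟ i₂
  ... | u , w , u≢w , u∈ , w∈ | no row≢i₂ =
    spread (fan t i₂) (at₂ refl) (inCopy q u) (inCopy q w) (u≢w ∘ λ { refl → refl })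
           (at₁ (copy∋ u∈)) (at₁ (copy∋ w∈)) (fan∌copy row≢i₂) (fan∌copy row≢i₂)
  ... | u , w , u≢w , u∈ , w∈ | yes refl =
    spread (fan t i₃) (at₃ refl) (inCopy q u) (inCopy q w) (u≢w ∘ λ { refl → refl })
           (at₁ (copy∋ u∈)) (at₁ (copy∋ w∈)) (fan∌copy (c₂≢c₃ ∘ cong (t ,_))) (fan∌copy (c₂≢c₃ ∘ cong (t ,_)))

  leg-injective : ∀ {t t′ i i′ j j′} → leg t i j ≡ leg t′ i′ j′ → i ≡ i′
  leg-injective {i = i} {i′} {j} {j′} eq = combine-injectiveˡ i j i′ j′ (cong proj₁ (inj₁-injective eq))

  spread-common-apex : ∀ {t i₁ i₂ i₃} → i₁ ≢ i₂ → i₁ ≢ i₃ → i₂ ≢ i₃ →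
    Spread _∋_ (fan t i₁) (fan t i₂) (fan t i₃)
  spread-common-apex {t} {i₁} {i₂} {i₃} i₁≢i₂ i₁≢i₃ i₂≢i₃ =
    spread (fan t i₁) (at₁ refl) (leg t i₂ zero) (leg t i₃ zero) (i₂≢i₃ ∘ leg-injective)
           (at₂ fan∋leg) (at₃ fan∋leg) (fan∌leg (i₁≢i₂ ∘ sym)) (fan∌leg (i₁≢i₃ ∘ sym))

  spread-two-apices : ∀ {t t′ i₁ i₂ i₃} → t ≢ t′ → i₁ ≢ i₂ →
    Spread _∋_ (fan t i₁) (fan t i₂) (fan t′ i₃)
  spread-two-apices {t} {t′} {i₁} {i₂} {i₃} t≢t′ i₁≢i₂ with i₁ ≟ i₃
  ... | no i₁≢i₃ =
    spread (fan t′ i₃) (at₃ refl) (apex t) (leg t i₁ zero) (λ ())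
           (at₁ apex∋) (at₁ fan∋leg) (fan∌apex t≢t′) (fan∌leg i₁≢i₃)
  ... | yes refl =
    spread (fan t′ i₁) (at₃ refl) (apex t) (leg t i₂ zero) (λ ())
           (at₁ apex∋) (at₂ fan∋leg) (fan∌apex t≢t′) (fan∌leg (i₁≢i₂ ∘ sym))

  spread-three-apices : ∀ {t₁ t₂ t₃ i₁ i₂ i₃} → t₁ ≢ t₂ → t₁ ≢ t₃ → t₂ ≢ t₃ →
    Spread _∋_ (fan t₁ i₁) (fan t₂ i₂) (fan t₃ i₃)
  spread-three-apices {t₁} {t₂} {t₃} {i₁} t₁≢t₂ t₁≢t₃ t₂≢t₃ =
    spread (fan t₁ i₁) (at₁ refl) (apex t₂) (apex t₃) (t₂≢t₃ ∘ λ { refl → refl })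
           (at₂ apex∋) (at₃ apex∋) (fan∌apex (t₁≢t₂ ∘ sym)) (fan∌apex (t₁≢t₃ ∘ sym))

  spread-fan-fan-fan : ∀ {t₁ t₂ t₃ i₁ i₂ i₃} → (t₁ , i₁) ≢ (t₂ , i₂) → (t₁ , i₁) ≢ (t₃ , i₃) → (t₂ , i₂) ≢ (t₃ , i₃) →
    Spread _∋_ (fan t₁ i₁) (fan t₂ i₂) (fan t₃ i₃)
  spread-fan-fan-fan {t₁} {t₂} {t₃} c₁≢c₂ c₁≢c₃ c₂≢c₃ with t₁ ≟ t₂ | t₁ ≟ t₃ | t₂ ≟ t₃
  ... | yes refl | yes refl | _ =
    spread-common-apex (c₁≢c₂ ∘ cong (t₁ ,_)) (c₁≢c₃ ∘ cong (t₁ ,_)) (c₂≢c₃ ∘ cong (t₁ ,_))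
  ... | yes refl | no t₁≢t₃ | _        = spread-two-apices t₁≢t₃ (c₁≢c₂ ∘ cong (t₁ ,_))
  ... | no t₁≢t₂ | yes refl | _        = Spread-reorder swap₂₃ (spread-two-apices t₁≢t₂ (c₁≢c₃ ∘ cong (t₁ ,_)))
  ... | no _     | no t₁≢t₃ | yes refl =
    Spread-reorder (swap₁₂ ∘ swap₂₃) (spread-two-apices (t₁≢t₃ ∘ sym) (c₂≢c₃ ∘ cong (t₂ ,_)))
  ... | no t₁≢t₂ | no t₁≢t₃ | no t₂≢t₃ = spread-three-apices t₁≢t₂ t₁≢t₃ t₂≢t₃

  codes-stronglyTriangleFree : StronglyTriangleFree (_∋ᴳ_ {G}) → StronglyTriangleFree _∋_
  codes-stronglyTriangleFree stf (inCopy _ _) (inCopy _ _) (inCopy _ _) c₁≢c₂ c₁≢c₃ c₂≢c₃ =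
    spread-copy-copy-copy stf (c₁≢c₂ ∘ cong inj₁) (c₁≢c₃ ∘ cong inj₁) (c₂≢c₃ ∘ cong inj₁)
  codes-stronglyTriangleFree stf (inCopy _ _) (inCopy _ _) (fan _ _)    c₁≢c₂ _ _ =
    spread-copy-copy-fan (c₁≢c₂ ∘ cong inj₁)
  codes-stronglyTriangleFree stf (inCopy _ _) (fan _ _)    (inCopy _ _) _ c₁≢c₃ _ =
    Spread-reorder swap₂₃ (spread-copy-copy-fan (c₁≢c₃ ∘ cong inj₁))
  codes-stronglyTriangleFree stf (fan _ _)    (inCopy _ _) (inCopy _ _) _ _ c₂≢c₃ =
    Spread-reorder (swap₁₂ ∘ swap₂₃) (spread-copy-copy-fan (c₂≢c₃ ∘ cong inj₁))
  codes-stronglyTriangleFree stf (inCopy _ _) (fan _ _)    (fan _ _)    _ _ c₂≢c₃ =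
    spread-copy-fan-fan (c₂≢c₃ ∘ cong inj₂)
  codes-stronglyTriangleFree stf (fan _ _)    (inCopy _ _) (fan _ _)    _ c₁≢c₃ _ =
    Spread-reorder swap₁₂ (spread-copy-fan-fan (c₁≢c₃ ∘ cong inj₂))
  codes-stronglyTriangleFree stf (fan _ _)    (fan _ _)    (inCopy _ _) c₁≢c₂ _ _ =
    Spread-reorder (swap₂₃ ∘ swap₁₂) (spread-copy-fan-fan (c₁≢c₂ ∘ cong inj₂))
  codes-stronglyTriangleFree stf (fan _ _)    (fan _ _)    (fan _ _)    c₁≢c₂ c₁≢c₃ c₂≢c₃ =
    spread-fan-fan-fan (c₁≢c₂ ∘ cong inj₂) (c₁≢c₃ ∘ cong inj₂) (c₂≢c₃ ∘ cong inj₂)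

  G′-stronglyTriangleFree : StronglyTriangleFree (_∋ᴳ_ {G}) → StronglyTriangleFree (_∋ᴳ_ {G′})
  G′-stronglyTriangleFree stf ε₁ ε₂ ε₃ ε₁≢ε₂ ε₁≢ε₃ ε₂≢ε₃
    with image-of-inverse edgeCode ε₁ | image-of-inverse edgeCode ε₂ | image-of-inverse edgeCode ε₃
  ... | image c₁ | image c₂ | image c₃ =
    Spread-map encodeᵉ encodeᵛ encodeᵛ-injective ∋⇒∈ ∈⇒∋
      (codes-stronglyTriangleFree stf c₁ c₂ c₃ (ε₁≢ε₂ ∘ cong encodeᵉ) (ε₁≢ε₃ ∘ cong encodeᵉ) (ε₂≢ε₃ ∘ cong encodeᵉ))

record Witness (s k : ℕ) : Set where
  field
    graph                : Hypergraph
    uniform              : Uniform (suc (suc s)) graph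
    stronglyTriangleFree : StronglyTriangleFree (_∋ᴳ_ {graph})
    degenerate           : Degenerate (ℕ.pred k) graph
    chromatic            : ChromaticNumber graph k

empty : Hypergraph
empty = record { n = 0 ; m = 0 ; edge = λ () ; edge-inj = λ { {()} } }

witness : ∀ s k → Witness s k
witness s zero = record
  { graph                = empty
  ; uniform              = λ ()
  ; stronglyTriangleFree = λ ()
  ; degenerate           = λ { _ (() , _) }
  ; chromatic            = ((λ ()) , λ ()) , λ { _ () }
  }
witness s (suc k) = record
  { graph                = G′
  ; uniform              = G′-uniform
  ; stronglyTriangleFree = G′-stronglyTriangleFree stronglyTriangleFree
  ; degenerate           = G′-degenerate degenerate
  ; chromatic            = G′-chromatic chromatic
  }
  where
  open Witness (witness s k)
  open Extension s k graph uniform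

theorem3 : ∀ (r d : ℕ) → 2 ≤ r → 1 ≤ d →
    ∃ λ (G : Hypergraph) →
    TriangleFree r G × Degenerate d G × Uniform r G × ChromaticNumber G (suc d)
theorem3 (suc (suc s)) d (s≤s (s≤s z≤n)) _ =
  graph , stronglyTriangleFree⇒triangleFree {G = graph} uniform stronglyTriangleFree , degenerate , uniform , chromatic
  where open Witness (witness s (suc d))
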